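{- Let $G=(V,E)$ be an undirected graph on $n=|V|$ vertices with arboricity $\alpha(G)\le \alpha$, let $\beta>1$ be a real parameter, and set $\gamma=\beta\cdot\alpha$. Suppose the edges of $G$ are oriented so that every vertex $w\in V$ has at least $\min\{\mathrm{d}^+(w),\gamma\}$ outgoing edges that are valid. Then the maximum out-degree of the orientation satisfies $$\Delta\le \beta\cdot\alpha(G)+\lceil \log_\beta n\rceil .$$
   Context: The arboricity $\alpha(G)$ of an undirected graph $G=(V,E)$ is the smallest integer $a\ge 1$ such that every nonempty $U\subseteq V$ satisfies $|E(U)|\le a(|U|-1)$, where $E(U)$ is the set of edges with both endpoints in $U$. The parameter $\alpha$ is any number with $\alpha(G)\le\alpha$. An orientation assigns a direction to each edge; $u\to v$ denotes an edge oriented from $u$ to $v$. The out-degree $\mathrm{d}^+(u)$ is the number of edges oriented out of $u$, and $\Delta=\max_{v\in V}\mathrm{d}^+(v)$. An edge oriented $u\to v$ is called valid if $\mathrm{d}^+(u)\le \mathrm{d}^+(v)+1$.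
   Formalization: The parameter β and the number α bounding the arboricity range only over the rationals rather than the reals. -}

module Defs where

open import Data.Bool using (Bool; true; false; _∧_; T)
open import Data.Nat as ℕ using (ℕ; zero; suc; _∸_; _≤ᵇ_; _<ᵇ_)
open import Data.Fin using (Fin; toℕ)
open import Data.Fin.Subset using (Subset; ∣_∣; Nonempty)
open import Data.Vec using (lookup)
open import Data.List using (List; length; filterᵇ; allFin; map)
open import Data.Nat.ListAction using (sum)
open import Data.Integer using (+_)
open import Data.Rational using (ℚ; _/_; _*_; 1ℚ; _≤_; _<_)
open import Data.Product using (_×_)
open import Data.Sum using (_⊎_)
open import Relation.Binary.PropositionalEquality using (_≡_)

ℕ→ℚ : ℕ → ℚ
ℕ→ℚ m = + m / 1

_^ℚ_ : ℚ → ℕ → ℚ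
q ^ℚ zero  = 1ℚ
q ^ℚ suc k = q * (q ^ℚ k)

count : ∀ {n} → (Fin n → Bool) → ℕ
count {n} p = length (filterᵇ p (allFin n))

record Graph (n : ℕ) : Set where
  field
    adj   : Fin n → Fin n → Bool
    sym   : ∀ u v → adj u v ≡ adj v u
    irrefl : ∀ u → adj u u ≡ false
open Graph public

-- |E(U)|: number of edges {u,v} (counted once, via toℕ u < toℕ v) with both ends in U
edgesIn : ∀ {n} → Graph n → Subset n → ℕ
edgesIn {n} G U =
  sum (map (λ u → count (λ v → lookup U u ∧ lookup U v ∧ adj G u v ∧ (toℕ u <ᵇ toℕ v)))
           (allFin n))

ArbBound : ∀ {n} → Graph n → ℕ → Set
ArbBound {n} G a = ∀ (U : Subset n) → Nonempty U → edgesIn G U ℕ.≤ a ℕ.* (∣ U ∣ ∸ 1)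

IsArboricity : ∀ {n} → Graph n → ℕ → Set
IsArboricity G a = (1 ℕ.≤ a) × ArbBound G a × (∀ b → 1 ℕ.≤ b → ArbBound G b → a ℕ.≤ b)

-- an orientation of G: dir u v = true means the edge {u,v} is oriented u → v;
-- every edge gets exactly one direction, non-edges get none
record Orientation {n : ℕ} (G : Graph n) : Set where
  field
    dir      : Fin n → Fin n → Bool
    dir-edge : ∀ u v → dir u v ≡ true → adj G u v ≡ true
    dir-one  : ∀ u v → adj G u v ≡ true →
               (dir u v ≡ true × dir v u ≡ false) ⊎ (dir u v ≡ false × dir v u ≡ true)
open Orientation public

outdeg : ∀ {n} {G : Graph n} → Orientation G → Fin n → ℕ
outdeg o u = count (λ v → dir o u v)

validOut : ∀ {n} {G : Graph n} → Orientation G → Fin n → ℕ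
validOut o u = count (λ v → dir o u v ∧ (outdeg o u ≤ᵇ suc (outdeg o v)))

IsCeilLog : ℚ → ℕ → ℕ → Set
IsCeilLog β n k = (ℕ→ℚ n ≤ β ^ℚ k) × (∀ j → j ℕ.< k → β ^ℚ j < ℕ→ℚ n)

{-# OPTIONS --safe #-}
module Submission where

-- Suppose d⁺(v) > β·α(G) + k with k = ⌈log_β n⌉, and let Lᵢ be the set of vertices u with
-- d⁺(u) ≥ d⁺(v) − i. For i ≤ k every u ∈ Lᵢ has d⁺(u) ≥ β·α(G), hence at least β·α(G) valid
-- out-arcs, and a valid arc out of Lᵢ ends in Lᵢ₊₁. These arcs are edges of the subgraph induced
-- by Lᵢ₊₁, which has at most α(G)·|Lᵢ₊₁| edges, so β·|Lᵢ| ≤ |Lᵢ₊₁|. Since v ∈ L₀ this gives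
-- n ≥ |Lₖ₊₁| ≥ β^(k+1) > β^k ≥ n.

module Counting where

  open import Defs hiding (sym)
  open import Data.Bool using (Bool; true; false; _∧_)
  open import Data.Nat using (ℕ; zero; suc; _+_; _*_; _∸_; _≤_; _≤ᵇ_; _<ᵇ_; z≤n)
  open import Data.Nat.Properties
  import Data.Nat.ListAction as List
  open import Data.List using (List; []; _∷_; length; filterᵇ; map; allFin; tabulate)
  open import Data.List.Properties using (map-tabulate; length-filter; length-tabulate)
  open import Data.Fin using (Fin; zero; suc; toℕ)
  open import Data.Fin.Properties using (toℕ-injective)
  open import Data.Fin.Subset using (∣_∣; _∈_)
  import Data.Vec as Vec
  open import Data.Vec.Properties using (lookup∘tabulate; lookup⇒[]=)
  open import Algebra.Properties.CommutativeMonoid.Sum +-0-commutativeMonoid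
    using (sum; sum-syntax; ∑-comm; ∑-distrib-+; sum-cong-≗)
  open import Data.Product using (_,_)
  open import Data.Sum using (inj₁; inj₂)
  open import Function using (_∘_; id)
  open import Relation.Binary.PropositionalEquality
  open import Relation.Nullary using (contradiction)
  open import Relation.Nullary.Decidable using (T?)

  χ : Bool → ℕ
  χ false = 0
  χ true  = 1

  length-filterᵇ : ∀ {A : Set} (p : A → Bool) (xs : List A) →
                   length (filterᵇ p xs) ≡ List.sum (map (χ ∘ p) xs)
  length-filterᵇ p []       = refl
  length-filterᵇ p (x ∷ xs) with p x
  ... | true  = cong suc (length-filterᵇ p xs)
  ... | false = length-filterᵇ p xs

  sum-tabulate : ∀ {n} (f : Fin n → ℕ) → List.sum (tabulate f) ≡ sum f
  sum-tabulate {zero}  f = refl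
  sum-tabulate {suc n} f = cong (f zero +_) (sum-tabulate (f ∘ suc))

  sum-map-allFin : ∀ {n} (f : Fin n → ℕ) → List.sum (map f (allFin n)) ≡ sum f
  sum-map-allFin f = trans (cong List.sum (map-tabulate id f)) (sum-tabulate f)

  count≡∑χ : ∀ {n} (p : Fin n → Bool) → count p ≡ ∑[ u < n ] χ (p u)
  count≡∑χ {n} p = trans (length-filterᵇ p (allFin n)) (sum-map-allFin (χ ∘ p))

  count≤n : ∀ {n} (p : Fin n → Bool) → count p ≤ n
  count≤n {n} p = ≤-trans (length-filter (T? ∘ p) (allFin n)) (≤-reflexive (length-tabulate id))

  ∣tabulate∣≡∑χ : ∀ {n} (p : Fin n → Bool) → ∣ Vec.tabulate p ∣ ≡ ∑[ u < n ] χ (p u)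
  ∣tabulate∣≡∑χ {zero}  p = refl
  ∣tabulate∣≡∑χ {suc n} p with p zero
  ... | true  = cong suc (∣tabulate∣≡∑χ (p ∘ suc))
  ... | false = ∣tabulate∣≡∑χ (p ∘ suc)

  ∣tabulate∣≡count : ∀ {n} (p : Fin n → Bool) → ∣ Vec.tabulate p ∣ ≡ count p
  ∣tabulate∣≡count p = trans (∣tabulate∣≡∑χ p) (sym (count≡∑χ p))

  ∑-mono-≤ : ∀ {n} {f g : Fin n → ℕ} → (∀ i → f i ≤ g i) → sum f ≤ sum g
  ∑-mono-≤ {zero}  f≤g = z≤n
  ∑-mono-≤ {suc n} f≤g = +-mono-≤ (f≤g zero) (∑-mono-≤ (f≤g ∘ suc))

  term≤∑ : ∀ {n} (f : Fin n → ℕ) (i : Fin n) → f i ≤ sum f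
  term≤∑ f zero    = m≤m+n (f zero) _
  term≤∑ f (suc i) = ≤-trans (term≤∑ (f ∘ suc) i) (m≤n+m _ (f zero))

  1≤count : ∀ {n} (p : Fin n → Bool) {v : Fin n} → p v ≡ true → 1 ≤ count p
  1≤count p {v} pv = begin
    1            ≡⟨ cong χ pv ⟨
    χ (p v)      ≤⟨ term≤∑ (χ ∘ p) v ⟩
    sum (χ ∘ p)  ≡⟨ count≡∑χ p ⟨
    count p      ∎
    where open ≤-Reasoning

  ∑∑-symmetrize : ∀ {n} (f : Fin n → Fin n → ℕ) →
                  ∑[ u < n ] ∑[ w < n ] (f u w + f w u)
                    ≡ ∑[ u < n ] ∑[ w < n ] f u w + ∑[ u < n ] ∑[ w < n ] f u w
  ∑∑-symmetrize {n} f = begin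
    ∑[ u < n ] ∑[ w < n ] (f u w + f w u)
      ≡⟨ sum-cong-≗ (λ u → ∑-distrib-+ (f u) (λ w → f w u)) ⟩
    ∑[ u < n ] (∑[ w < n ] f u w + ∑[ w < n ] f w u)
      ≡⟨ ∑-distrib-+ (λ u → ∑[ w < n ] f u w) (λ u → ∑[ w < n ] f w u) ⟩
    ∑[ u < n ] ∑[ w < n ] f u w + ∑[ u < n ] ∑[ w < n ] f w u
      ≡⟨ cong (∑[ u < n ] ∑[ w < n ] f u w +_) (∑-comm (λ u w → f w u)) ⟩
    ∑[ u < n ] ∑[ w < n ] f u w + ∑[ u < n ] ∑[ w < n ] f u w
      ∎
    where open ≡-Reasoning

  m+m≡n+n⇒m≡n : ∀ {m n} → m + m ≡ n + n → m ≡ n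
  m+m≡n+n⇒m≡n {m} {n} eq = *-cancelˡ-≡ m n 2 (begin
    m + (m + 0)  ≡⟨ cong (m +_) (+-identityʳ m) ⟩
    m + m        ≡⟨ eq ⟩
    n + n        ≡⟨ cong (n +_) (+-identityʳ n) ⟨
    n + (n + 0)  ∎)
    where open ≡-Reasoning

  χ<ᵇ+χ>ᵇ≡1 : ∀ a b → a ≢ b → χ (a <ᵇ b) + χ (b <ᵇ a) ≡ 1
  χ<ᵇ+χ>ᵇ≡1 zero    zero    a≢b = contradiction refl a≢b
  χ<ᵇ+χ>ᵇ≡1 zero    (suc b) _   = refl
  χ<ᵇ+χ>ᵇ≡1 (suc a) zero    _   = refl
  χ<ᵇ+χ>ᵇ≡1 (suc a) (suc b) a≢b = χ<ᵇ+χ>ᵇ≡1 a b (a≢b ∘ cong suc)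

  module _ {n : ℕ} (G : Graph n) where

    edgesIn-tabulate : ∀ (P : Fin n → Bool) → edgesIn G (Vec.tabulate P)
                       ≡ ∑[ u < n ] ∑[ w < n ] χ (P u ∧ P w ∧ adj G u w ∧ (toℕ u <ᵇ toℕ w))
    edgesIn-tabulate P = trans (sum-map-allFin {n} _) (sum-cong-≗ λ u → trans (count≡∑χ {n} _)
      (sum-cong-≗ λ w → cong₂ (λ Pu Pw → χ (Pu ∧ Pw ∧ adj G u w ∧ (toℕ u <ᵇ toℕ w)))
                              (lookup∘tabulate P u) (lookup∘tabulate P w)))

    adj⇒toℕ≢ : ∀ u w → adj G u w ≡ true → toℕ u ≢ toℕ w
    adj⇒toℕ≢ u w uw eq with toℕ-injective eq
    ... | refl = contradiction (trans (sym uw) (irrefl G u)) λ ()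

  module _ {n : ℕ} {G : Graph n} (o : Orientation G) where

    validArc : Fin n → Fin n → Bool
    validArc u w = dir o u w ∧ (outdeg o u ≤ᵇ suc (outdeg o w))

    arcsWithin : (Fin n → Bool) → ℕ
    arcsWithin P = ∑[ u < n ] ∑[ w < n ] χ (P u ∧ P w ∧ dir o u w)

    ¬adj⇒¬dir : ∀ u w → adj G u w ≡ false → dir o u w ≡ false
    ¬adj⇒¬dir u w ¬uw with dir o u w in uw
    ... | false = refl
    ... | true  = contradiction (trans (sym (dir-edge o u w uw)) ¬uw) λ ()

    arc-pair≡edge-pair : ∀ u w → χ (dir o u w) + χ (dir o w u)
                         ≡ χ (adj G u w ∧ (toℕ u <ᵇ toℕ w)) + χ (adj G w u ∧ (toℕ w <ᵇ toℕ u))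
    arc-pair≡edge-pair u w rewrite Graph.sym G w u with adj G u w in uw
    ... | false rewrite ¬adj⇒¬dir u w uw | ¬adj⇒¬dir w u (trans (Graph.sym G w u) uw) = refl
    ... | true with dir-one o u w uw
    ...   | inj₁ (u→w , ¬w→u) rewrite u→w | ¬w→u = sym (χ<ᵇ+χ>ᵇ≡1 _ _ (adj⇒toℕ≢ G u w uw))
    ...   | inj₂ (¬u→w , w→u) rewrite ¬u→w | w→u = sym (χ<ᵇ+χ>ᵇ≡1 _ _ (adj⇒toℕ≢ G u w uw))

    arc-pair≡edge-pair-within : ∀ (P : Fin n → Bool) u w →
      χ (P u ∧ P w ∧ dir o u w) + χ (P w ∧ P u ∧ dir o w u)
        ≡ χ (P u ∧ P w ∧ adj G u w ∧ (toℕ u <ᵇ toℕ w)) + χ (P w ∧ P u ∧ adj G w u ∧ (toℕ w <ᵇ toℕ u))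
    arc-pair≡edge-pair-within P u w with P u | P w
    ... | true  | true  = arc-pair≡edge-pair u w
    ... | true  | false = refl
    ... | false | _     = refl

    -- Summing every pair in both orders removes the u < w tie-break of edgesIn, after which
    -- each edge contributes exactly one arc.
    arcsWithin≡edgesIn : ∀ (P : Fin n → Bool) → arcsWithin P ≡ edgesIn G (Vec.tabulate P)
    arcsWithin≡edgesIn P = m+m≡n+n⇒m≡n (begin
      arcsWithin P + arcsWithin P
        ≡⟨ ∑∑-symmetrize (λ u w → χ (P u ∧ P w ∧ dir o u w)) ⟨
      ∑[ u < n ] ∑[ w < n ] (χ (P u ∧ P w ∧ dir o u w) + χ (P w ∧ P u ∧ dir o w u))
        ≡⟨ sum-cong-≗ (λ u → sum-cong-≗ (arc-pair≡edge-pair-within P u)) ⟩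
      ∑[ u < n ] ∑[ w < n ] (Eᴾ u w + Eᴾ w u)
        ≡⟨ ∑∑-symmetrize Eᴾ ⟩
      ∑[ u < n ] ∑[ w < n ] Eᴾ u w + ∑[ u < n ] ∑[ w < n ] Eᴾ u w
        ≡⟨ cong₂ _+_ (edgesIn-tabulate G P) (edgesIn-tabulate G P) ⟨
      edgesIn G (Vec.tabulate P) + edgesIn G (Vec.tabulate P) ∎)
      where
      open ≡-Reasoning
      Eᴾ : Fin n → Fin n → ℕ
      Eᴾ u w = χ (P u ∧ P w ∧ adj G u w ∧ (toℕ u <ᵇ toℕ w))

    arcsWithin≤ : ∀ {a} → ArbBound G a → (P : Fin n → Bool) {v : Fin n} → P v ≡ true →
                  arcsWithin P ≤ a * count P
    arcsWithin≤ {a} arb P {v} Pv = begin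
      arcsWithin P                  ≡⟨ arcsWithin≡edgesIn P ⟩
      edgesIn G (Vec.tabulate P)    ≤⟨ arb (Vec.tabulate P) (v , v∈P) ⟩
      a * (∣ Vec.tabulate P ∣ ∸ 1)  ≤⟨ *-monoʳ-≤ a (m∸n≤m _ 1) ⟩
      a * ∣ Vec.tabulate P ∣        ≡⟨ cong (a *_) (∣tabulate∣≡count P) ⟩
      a * count P                   ∎
      where
      open ≤-Reasoning
      v∈P : v ∈ Vec.tabulate P
      v∈P = lookup⇒[]= v (Vec.tabulate P) (trans (lookup∘tabulate P v) Pv)

    ∑validOut≤arcsWithin :
      ∀ (Q P : Fin n → Bool) → (∀ u → Q u ≡ true → P u ≡ true) →
      (∀ u w → Q u ≡ true → dir o u w ≡ true → (outdeg o u ≤ᵇ suc (outdeg o w)) ≡ true → P w ≡ true) →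
      ∑[ u < n ] (χ (Q u) * validOut o u) ≤ arcsWithin P
    ∑validOut≤arcsWithin Q P Q⊆P valid⇒P = ∑-mono-≤ validOut≤arcs
      where
      validOut≤arcs : ∀ u → χ (Q u) * validOut o u ≤ ∑[ w < n ] χ (P u ∧ P w ∧ dir o u w)
      validOut≤arcs u with Q u in Qu
      ... | false = z≤n
      ... | true rewrite +-identityʳ (validOut o u) | count≡∑χ (validArc u) | Q⊆P u Qu = ∑-mono-≤ validArc≤arc
        where
        validArc≤arc : ∀ w → χ (validArc u w) ≤ χ (P w ∧ dir o u w)
        validArc≤arc w with dir o u w in u→w | outdeg o u ≤ᵇ suc (outdeg o w) in valid
        ... | false | _     = z≤n
        ... | true  | false = z≤n
        ... | true  | true rewrite valid⇒P u w Qu u→w valid = ≤-refl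

module Rational where

  open import Defs hiding (sym)
  open import Data.Nat as ℕ using (ℕ; zero; suc)
  import Data.Nat.Properties as ℕ
  open import Data.Integer as ℤ using (+_)
  import Data.Integer.Properties as ℤ
  open import Data.Rational using (ℚ; mkℚ; 0ℚ; 1ℚ; _+_; _*_; _≤_; _<_; *≤*; NonNegative; positive)
  open import Data.Rational.Properties
  import Data.Nat.Coprimality as Coprime
  open import Data.Fin using (Fin; zero; suc)
  open import Algebra.Properties.CommutativeMonoid.Sum ℕ.+-0-commutativeMonoid using (sum)
  open import Function using (_∘_)
  open import Relation.Binary.PropositionalEquality

  ℕ→ℚ≡mkℚ : ∀ m → ℕ→ℚ m ≡ mkℚ (+ m) 0 (Coprime.sym (Coprime.1-coprimeTo m))
  ℕ→ℚ≡mkℚ m = normalize-coprime _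

  ℕ→ℚ-+ : ∀ a b → ℕ→ℚ (a ℕ.+ b) ≡ ℕ→ℚ a + ℕ→ℚ b
  ℕ→ℚ-+ a b rewrite ℕ→ℚ≡mkℚ a | ℕ→ℚ≡mkℚ b =
    /-cong (sym (cong₂ ℤ._+_ (ℤ.*-identityʳ (+ a)) (ℤ.*-identityʳ (+ b)))) refl

  ℕ→ℚ-* : ∀ a b → ℕ→ℚ (a ℕ.* b) ≡ ℕ→ℚ a * ℕ→ℚ b
  ℕ→ℚ-* a b rewrite ℕ→ℚ≡mkℚ a | ℕ→ℚ≡mkℚ b = /-cong (ℤ.pos-* a b) refl

  ℕ→ℚ-mono-≤ : ∀ {a b} → a ℕ.≤ b → ℕ→ℚ a ≤ ℕ→ℚ b
  ℕ→ℚ-mono-≤ {a} {b} a≤b rewrite ℕ→ℚ≡mkℚ a | ℕ→ℚ≡mkℚ b =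
    *≤* (ℤ.*-monoʳ-≤-nonNeg (+ 1) (ℤ.+≤+ a≤b))

  ∑-scale-≤ : ∀ {n} (x : ℚ) (w g : Fin n → ℕ) → (∀ u → x * ℕ→ℚ (w u) ≤ ℕ→ℚ (g u)) →
              x * ℕ→ℚ (sum w) ≤ ℕ→ℚ (sum g)
  ∑-scale-≤ {zero}  x w g xw≤g = ≤-reflexive (*-zeroʳ x)
  ∑-scale-≤ {suc n} x w g xw≤g = begin
    x * ℕ→ℚ (w zero ℕ.+ sum (w ∘ suc))            ≡⟨ cong (x *_) (ℕ→ℚ-+ (w zero) _) ⟩
    x * (ℕ→ℚ (w zero) + ℕ→ℚ (sum (w ∘ suc)))      ≡⟨ *-distribˡ-+ x _ _ ⟩
    x * ℕ→ℚ (w zero) + x * ℕ→ℚ (sum (w ∘ suc))    ≤⟨ +-mono-≤ (xw≤g zero) (∑-scale-≤ x (w ∘ suc) (g ∘ suc) (xw≤g ∘ suc)) ⟩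
    ℕ→ℚ (g zero) + ℕ→ℚ (sum (g ∘ suc))            ≡⟨ ℕ→ℚ-+ (g zero) _ ⟨
    ℕ→ℚ (g zero ℕ.+ sum (g ∘ suc))                ∎
    where open ≤-Reasoning

  +-cancelʳ-≤ : ∀ r {p q} → p + r ≤ q + r → p ≤ q
  +-cancelʳ-≤ r p+r≤q+r = ≮⇒≥ λ q<p → <-irrefl refl (<-≤-trans (+-monoˡ-< r q<p) p+r≤q+r)

  p<q*p : ∀ {p q} → 1ℚ < q → 0ℚ < p → p < q * p
  p<q*p {p} {q} 1<q 0<p = subst (_< q * p) (*-identityˡ p) (*-monoˡ-<-pos p {{positive 0<p}} 1<q)

  ^ℚ-≤-of-growth : ∀ (β : ℚ) .{{_ : NonNegative β}} (c : ℕ → ℚ) (k : ℕ) → 1ℚ ≤ c 0 →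
                   (∀ i → i ℕ.< k → β * c i ≤ c (suc i)) → ∀ i → i ℕ.≤ k → β ^ℚ i ≤ c i
  ^ℚ-≤-of-growth β c k 1≤c₀ grow zero    _   = 1≤c₀
  ^ℚ-≤-of-growth β c k 1≤c₀ grow (suc i) i<k = begin
    β * β ^ℚ i  ≤⟨ *-monoˡ-≤-nonNeg β (^ℚ-≤-of-growth β c k 1≤c₀ grow i (ℕ.<⇒≤ i<k)) ⟩
    β * c i     ≤⟨ grow i i<k ⟩
    c (suc i)   ∎
    where open ≤-Reasoning

module Expansion where

  open import Defs hiding (sym)
  open Counting
  open Rational
  open import Data.Bool using (Bool; true; false)
  open import Data.Bool.Properties using (T-≡)
  open import Data.Nat as ℕ using (ℕ; suc; _≤ᵇ_)
  import Data.Nat.Properties as ℕ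
  open import Data.Rational using (ℚ; 1ℚ; _+_; _*_; _≤_; _<_; positive)
  open import Data.Rational.Properties
  open import Data.Fin using (Fin)
  open import Algebra.Properties.CommutativeMonoid.Sum ℕ.+-0-commutativeMonoid using (sum-syntax)
  open import Function using (_∘_; Equivalence)
  open import Relation.Binary.PropositionalEquality

  module _ {n : ℕ} {G : Graph n} (o : Orientation G) where

    validOut-expansion :
      ∀ {a} → ArbBound G a → 1 ℕ.≤ a → (β : ℚ) (Q P : Fin n → Bool) →
      (∀ u → Q u ≡ true → P u ≡ true) →
      (∀ u w → Q u ≡ true → dir o u w ≡ true → (outdeg o u ≤ᵇ suc (outdeg o w)) ≡ true → P w ≡ true) →
      (∀ u → Q u ≡ true → β * ℕ→ℚ a ≤ ℕ→ℚ (validOut o u)) →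
      ∀ {v} → P v ≡ true → β * ℕ→ℚ (count Q) ≤ ℕ→ℚ (count P)
    validOut-expansion {a} arb 1≤a β Q P Q⊆P valid⇒P βa≤validOut Pv =
      *-cancelˡ-≤-pos (ℕ→ℚ a) {{positive (<-≤-trans (positive⁻¹ 1ℚ) (ℕ→ℚ-mono-≤ 1≤a))}} (begin
        ℕ→ℚ a * (β * ℕ→ℚ (count Q))
          ≡⟨ trans (sym (*-assoc (ℕ→ℚ a) β _)) (cong (_* ℕ→ℚ (count Q)) (*-comm (ℕ→ℚ a) β)) ⟩
        (β * ℕ→ℚ a) * ℕ→ℚ (count Q)
          ≡⟨ cong (λ m → (β * ℕ→ℚ a) * ℕ→ℚ m) (count≡∑χ Q) ⟩
        (β * ℕ→ℚ a) * ℕ→ℚ (∑[ u < n ] χ (Q u))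
          ≤⟨ ∑-scale-≤ (β * ℕ→ℚ a) (χ ∘ Q) (λ u → χ (Q u) ℕ.* validOut o u) βa≤validOut-on-Q ⟩
        ℕ→ℚ (∑[ u < n ] (χ (Q u) ℕ.* validOut o u))
          ≤⟨ ℕ→ℚ-mono-≤ (ℕ.≤-trans (∑validOut≤arcsWithin o Q P Q⊆P valid⇒P) (arcsWithin≤ o {a} arb P Pv)) ⟩
        ℕ→ℚ (a ℕ.* count P)
          ≡⟨ ℕ→ℚ-* a (count P) ⟩
        ℕ→ℚ a * ℕ→ℚ (count P) ∎)
      where
      open ≤-Reasoning
      βa≤validOut-on-Q : ∀ u → (β * ℕ→ℚ a) * ℕ→ℚ (χ (Q u)) ≤ ℕ→ℚ (χ (Q u) ℕ.* validOut o u)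
      βa≤validOut-on-Q u with Q u in Qu
      ... | false = ≤-reflexive (*-zeroʳ (β * ℕ→ℚ a))
      ... | true  = begin
        (β * ℕ→ℚ a) * 1ℚ             ≡⟨ *-identityʳ (β * ℕ→ℚ a) ⟩
        β * ℕ→ℚ a                    ≤⟨ βa≤validOut u Qu ⟩
        ℕ→ℚ (validOut o u)           ≡⟨ cong ℕ→ℚ (ℕ.+-identityʳ (validOut o u)) ⟨
        ℕ→ℚ (1 ℕ.* validOut o u)     ∎

  module Layers {n : ℕ} {G : Graph n} (o : Orientation G) (v : Fin n) where

    layer : ℕ → Fin n → Bool
    layer i u = outdeg o v ≤ᵇ outdeg o u ℕ.+ i

    ∈layer⇒≤ : ∀ {i u} → layer i u ≡ true → outdeg o v ℕ.≤ outdeg o u ℕ.+ i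
    ∈layer⇒≤ u∈Lᵢ = ℕ.≤ᵇ⇒≤ _ _ (Equivalence.from T-≡ u∈Lᵢ)

    ≤⇒∈layer : ∀ {i u} → outdeg o v ℕ.≤ outdeg o u ℕ.+ i → layer i u ≡ true
    ≤⇒∈layer d⁺v≤d⁺u+i = Equivalence.to T-≡ (ℕ.≤⇒≤ᵇ d⁺v≤d⁺u+i)

    v∈layer : ∀ i → layer i v ≡ true
    v∈layer i = ≤⇒∈layer (ℕ.m≤m+n (outdeg o v) i)

    layer-⊆-suc : ∀ i u → layer i u ≡ true → layer (suc i) u ≡ true
    layer-⊆-suc i u u∈Lᵢ = ≤⇒∈layer (ℕ.≤-trans (∈layer⇒≤ u∈Lᵢ) (ℕ.+-monoʳ-≤ (outdeg o u) (ℕ.n≤1+n i)))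

    valid-arc-into-next-layer :
      ∀ i u w → layer i u ≡ true → dir o u w ≡ true → (outdeg o u ≤ᵇ suc (outdeg o w)) ≡ true →
      layer (suc i) w ≡ true
    valid-arc-into-next-layer i u w u∈Lᵢ _ valid = ≤⇒∈layer (begin
      outdeg o v                 ≤⟨ ∈layer⇒≤ u∈Lᵢ ⟩
      outdeg o u ℕ.+ i           ≤⟨ ℕ.+-monoˡ-≤ i (ℕ.≤ᵇ⇒≤ _ _ (Equivalence.from T-≡ valid)) ⟩
      suc (outdeg o w) ℕ.+ i     ≡⟨ ℕ.+-suc (outdeg o w) i ⟨
      outdeg o w ℕ.+ suc i       ∎)
      where open ℕ.≤-Reasoning

    high-layer-outdeg : ∀ {γ k i u} → γ + ℕ→ℚ k < ℕ→ℚ (outdeg o v) → i ℕ.≤ k →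
                        layer i u ≡ true → γ ≤ ℕ→ℚ (outdeg o u)
    high-layer-outdeg {γ} {k} {u = u} γ+k<d⁺v i≤k u∈Lᵢ = +-cancelʳ-≤ (ℕ→ℚ k) (begin
      γ + ℕ→ℚ k                  ≤⟨ <⇒≤ γ+k<d⁺v ⟩
      ℕ→ℚ (outdeg o v)           ≤⟨ ℕ→ℚ-mono-≤ (ℕ.≤-trans (∈layer⇒≤ u∈Lᵢ) (ℕ.+-monoʳ-≤ (outdeg o u) i≤k)) ⟩
      ℕ→ℚ (outdeg o u ℕ.+ k)     ≡⟨ ℕ→ℚ-+ (outdeg o u) k ⟩
      ℕ→ℚ (outdeg o u) + ℕ→ℚ k   ∎)
      where open ≤-Reasoning

open import Defs
open import Data.Nat using (ℕ; suc; s≤s; _≤_; _<_)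
open import Data.Nat.Properties using (≤-refl)
open import Data.Rational using (ℚ; 0ℚ; 1ℚ; _*_; _+_; _⊓_; NonNegative; nonNegative)
  renaming (_≤_ to _≤ℚ_; _<_ to _<ℚ_)
open import Data.Fin using (Fin)
open import Data.Rational.Properties
  using (≮⇒≥; <-irrefl; <⇒≤; <-trans; <-≤-trans; ≤-trans; positive⁻¹; ⊓-glb; *-monoˡ-≤-nonNeg; module ≤-Reasoning)
open import Data.Product using (_,_)
open import Relation.Binary.PropositionalEquality using (refl)
open Counting using (count≤n; 1≤count)
open Rational using (ℕ→ℚ-mono-≤; p<q*p; ^ℚ-≤-of-growth)
open Expansion using (validOut-expansion; module Layers)

theorem4 : (n : ℕ) → 1 ≤ n → (G : Graph n) → (aG : ℕ) → IsArboricity G aG →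
           (α : ℚ) → ℕ→ℚ aG ≤ℚ α → (β : ℚ) → 1ℚ <ℚ β → (o : Orientation G) →
           (∀ (w : Fin n) → (ℕ→ℚ (outdeg o w) ⊓ (β * α)) ≤ℚ ℕ→ℚ (validOut o w)) →
           (k : ℕ) → IsCeilLog β n k →
           ∀ (v : Fin n) → ℕ→ℚ (outdeg o v) ≤ℚ (β * ℕ→ℚ aG) + ℕ→ℚ k
theorem4 n 1≤n G aG (1≤aG , arb , _) α aG≤α β 1<β o valid≥ k (n≤β^k , _) v =
  ≮⇒≥ λ γ+k<d⁺v → <-irrefl refl (begin-strict
    β ^ℚ k                        <⟨ p<q*p 1<β 0<β^k ⟩
    β ^ℚ suc k                    ≤⟨ ^ℚ-≤-of-growth β size (suc k) 1≤size₀ (growth γ+k<d⁺v) (suc k) ≤-refl ⟩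
    size (suc k)                  ≤⟨ ℕ→ℚ-mono-≤ (count≤n (layer (suc k))) ⟩
    ℕ→ℚ n                         ≤⟨ n≤β^k ⟩
    β ^ℚ k                        ∎)
  where
  open Layers o v
  open ≤-Reasoning
  instance
    β≥0 : NonNegative β
    β≥0 = nonNegative (<⇒≤ (<-trans (positive⁻¹ 1ℚ) 1<β))
  size : ℕ → ℚ
  size i = ℕ→ℚ (count (layer i))
  0<β^k : 0ℚ <ℚ β ^ℚ k
  0<β^k = <-≤-trans (positive⁻¹ 1ℚ) (≤-trans (ℕ→ℚ-mono-≤ 1≤n) n≤β^k)
  1≤size₀ : 1ℚ ≤ℚ size 0
  1≤size₀ = ℕ→ℚ-mono-≤ (1≤count (layer 0) (v∈layer 0))
  growth : β * ℕ→ℚ aG + ℕ→ℚ k <ℚ ℕ→ℚ (outdeg o v) → ∀ i → i < suc k → β * size i ≤ℚ size (suc i)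
  growth γ+k<d⁺v i (s≤s i≤k) =
    validOut-expansion o arb 1≤aG β (layer i) (layer (suc i)) (layer-⊆-suc i) (valid-arc-into-next-layer i)
      (λ u u∈Lᵢ → ≤-trans (⊓-glb (high-layer-outdeg γ+k<d⁺v i≤k u∈Lᵢ) (*-monoˡ-≤-nonNeg β aG≤α)) (valid≥ u))
      (v∈layer (suc i))
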